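{- For every $d,\alpha,\beta\in(0,1]$ with $\beta<d$ there exist an integer $n_4$ and a real $\rho_4=\rho_4(d,\alpha,\beta)>0$ such that, with $c=\frac{d^2\alpha^9}{2^{48}}$, the following holds for any integer $n\geq n_4$ and $\rho<\rho_4$. Let $H$ be an $n$-vertex $(\rho,d)$-cherry-dense $3$-graph satisfying $\delta(H)\geq \alpha\binom{n-1}{2}$, and let $v\in V(H)$. Then there are at least $cn^4$ $(\beta,v)$-absorbers in $H$.
   Context: A $3$-graph is a $3$-uniform hypergraph; $\delta(H)$ is the minimum number of edges containing a vertex. For $G_1,G_2 \subseteq V(H)\times V(H)$ let $\mathcal{P}_2(G_1,G_2)=\{(x,y,z)\in V(H)^3 : (x,y)\in G_1,\ (y,z)\in G_2\}$ and $e_H(G_1,G_2)=|\{(x,y,z)\in \mathcal{P}_2(G_1,G_2): \{x,y,z\}\in E(H)\}|$. An $n$-vertex $H$ is $(\rho,d)$-cherry-dense if $e_H(G_1,G_2)\geq d|\mathcal{P}_2(G_1,G_2)|-\rho n^3$ for all $G_1,G_2\subseteq V(H)\times V(H)$. The codegree $\deg_H(u,v)$ is the number of $w$ with $\{u,v,w\}\in E(H)$; $H_\beta$ is obtained from $H$ by removing every edge containing a pair $\{u,v\}$ with $\deg_H(u,v)<\beta|V(H)|$. For $v\in V(H)$, a quadruple $(x,y,z,w)\in V(H)^4$ is a $(\beta,v)$-absorber if $\{x,y,z\},\{y,z,w\},\{v,x,y\},\{v,y,z\},\{v,z,w\}\in E(H)$ and $\{x,y,z\},\{y,z,w\}\in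 E(H_\beta)$.
   Formalization: The parameters d, α, β and ρ take rational values rather than real ones, and ρ₄ is also taken in the rationals. -}

module Defs where

open import Data.Bool using (Bool; true; false; _∧_; if_then_else_)
open import Data.Nat as ℕ using (ℕ; zero; suc; _^_)
open import Data.Nat.Combinatorics using (_C_)
open import Data.Fin using (Fin; zero; suc; toℕ)
open import Data.Integer using (+_)
open import Data.Rational using (ℚ; _/_; _*_; _-_; _≤_; _≤?_; 1ℚ)
open import Relation.Binary.PropositionalEquality using (_≡_)
open import Relation.Nullary.Decidable using (⌊_⌋)

count : ∀ {n} → (Fin n → Bool) → ℕ
count {zero}  P = 0
count {suc n} P = (if P zero then 1 else 0) ℕ.+ count (λ i → P (suc i))

ℕ→ℚ : ℕ → ℚ
ℕ→ℚ k = (+ k) / 1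

_^ℚ_ : ℚ → ℕ → ℚ
p ^ℚ zero  = 1ℚ
p ^ℚ suc k = p * (p ^ℚ k)

-- A 3-uniform hypergraph on vertex set Fin n: a Boolean edge indicator on
-- ordered triples which is invariant under permutations and vanishes on
-- triples with a repeated vertex; {x,y,z} ∈ E(H) iff edge x y z ≡ true.
record 3Graph (n : ℕ) : Set where
  field
    edge   : Fin n → Fin n → Fin n → Bool
    swap₁₂ : ∀ x y z → edge x y z ≡ edge y x z
    swap₂₃ : ∀ x y z → edge x y z ≡ edge x z y
    loop₁₂ : ∀ x z → edge x x z ≡ false
open 3Graph public

Rel₂ : ℕ → Set
Rel₂ n = Fin n → Fin n → Bool

sumF : ∀ {n} → (Fin n → ℕ) → ℕ
sumF {zero}  f = 0
sumF {suc n} f = f zero ℕ.+ sumF (λ i → f (suc i))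

|P₂| : ∀ {n} → Rel₂ n → Rel₂ n → ℕ
|P₂| G₁ G₂ = sumF λ x → sumF λ y → count λ z → G₁ x y ∧ G₂ y z

e[_] : ∀ {n} → 3Graph n → Rel₂ n → Rel₂ n → ℕ
e[ H ] G₁ G₂ = sumF λ x → sumF λ y → count λ z → G₁ x y ∧ G₂ y z ∧ edge H x y z

CherryDense : ∀ {n} → ℚ → ℚ → 3Graph n → Set
CherryDense {n} ρ d H = ∀ (G₁ G₂ : Rel₂ n) →
  d * ℕ→ℚ (|P₂| G₁ G₂) - ρ * ℕ→ℚ (n ^ 3) ≤ ℕ→ℚ (e[ H ] G₁ G₂)

-- deg_H(v): number of edges containing v (unordered pairs {x,y} with x < y)
deg : ∀ {n} → 3Graph n → Fin n → ℕ
deg H v = sumF λ x → count λ y → ⌊ toℕ x ℕ.<? toℕ y ⌋ ∧ edge H v x y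

MinDegAtLeast : ∀ {n} → 3Graph n → ℚ → Set
MinDegAtLeast {n} H a = ∀ v → ℕ→ℚ ((n ℕ.∸ 1) C 2) * a ≤ ℕ→ℚ (deg H v)

codeg : ∀ {n} → 3Graph n → Fin n → Fin n → ℕ
codeg H u v = count λ w → edge H u v w

heavy : ∀ {n} → 3Graph n → ℚ → Fin n → Fin n → Bool
heavy {n} H β u v = ⌊ β * ℕ→ℚ n ≤? ℕ→ℚ (codeg H u v) ⌋

edgeβ : ∀ {n} → 3Graph n → ℚ → Fin n → Fin n → Fin n → Bool
edgeβ H β x y z = edge H x y z ∧ heavy H β x y ∧ heavy H β y z ∧ heavy H β x z

isAbsorber : ∀ {n} → 3Graph n → ℚ → Fin n → Fin n → Fin n → Fin n → Fin n → Bool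
isAbsorber H β v x y z w =
  edge H x y z ∧ edge H y z w ∧ edge H v x y ∧ edge H v y z ∧ edge H v z w ∧
  edgeβ H β x y z ∧ edgeβ H β y z w

#absorbers : ∀ {n} → 3Graph n → ℚ → Fin n → ℕ
#absorbers H β v =
  sumF λ x → sumF λ y → sumF λ z → count λ w → isAbsorber H β v x y z w

-- Let L be the link graph of v and ext y z the number of w with yzw ∈ E(H) and zw ∈ L. Quadruples
-- (x,y,z,w) with xyz, yzw ∈ E(H) and xy, yz, zw ∈ L number Σ_{yz ∈ L} ext z y · ext y z. The minimum
-- degree makes L dense; pairs of L with an end of small L-degree are few, and cherry-density applied
-- to (pairs yz ∈ L with small ext y z whose end z has large L-degree, L) shows these are few too.
-- So α n² / 4 pairs of L have both extension counts at least α d n / 8, giving α³ d² n⁴ / 256 such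
-- quadruples. Cherry-density applied to (pairs of codegree < β n, all pairs) with β < d bounds the
-- number of these light pairs by ρ n² / (d − β), and each spoils at most 6 n² quadruples. Writing
-- α, d, β as fractions, all counting is done in ℕ with the denominators cleared.

module Submission where

module Sums where

  open import Defs using (sumF; count)
  import Algebra.Properties.Semiring.Sum
  open import Data.Bool.Base using (Bool; true; false; _∧_; if_then_else_; T)
  open import Data.Bool.Properties using (T-∧)
  open import Data.Product using (_×_)
  open import Function.Bundles using (Equivalence)
  open import Data.Fin.Base using (Fin; zero; suc)
  open import Data.Nat.Base using (ℕ; zero; suc; _+_; _*_; _≤_; z≤n)
  open import Data.Nat.Properties
  open import Function.Base using (_∘_)
  open import Relation.Binary.PropositionalEquality

  open Algebra.Properties.Semiring.Sum +-*-semiring using (sum; sum-cong-≗; ∑-distrib-+; ∑-comm; *-distribˡ-sum; *-distribʳ-sum)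

  ⟦_⟧ : Bool → ℕ
  ⟦ b ⟧ = if b then 1 else 0

  sumF≡sum : ∀ {n} (f : Fin n → ℕ) → sumF f ≡ sum f
  sumF≡sum {zero}  f = refl
  sumF≡sum {suc n} f = cong (f zero +_) (sumF≡sum (f ∘ suc))

  sumF-cong : ∀ {n} {f g : Fin n → ℕ} → (∀ i → f i ≡ g i) → sumF f ≡ sumF g
  sumF-cong {f = f} {g} f≗g = trans (sumF≡sum f) (trans (sum-cong-≗ f≗g) (sym (sumF≡sum g)))

  sumF-mono-≤ : ∀ {n} {f g : Fin n → ℕ} → (∀ i → f i ≤ g i) → sumF f ≤ sumF g
  sumF-mono-≤ {zero}  _   = z≤n
  sumF-mono-≤ {suc n} f≤g = +-mono-≤ (f≤g zero) (sumF-mono-≤ (f≤g ∘ suc))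

  sumF-distrib-+ : ∀ {n} (f g : Fin n → ℕ) → sumF (λ i → f i + g i) ≡ sumF f + sumF g
  sumF-distrib-+ f g =
    trans (sumF≡sum (λ i → f i + g i)) (trans (∑-distrib-+ f g) (sym (cong₂ _+_ (sumF≡sum f) (sumF≡sum g))))

  *-distribˡ-sumF : ∀ {n} c (f : Fin n → ℕ) → c * sumF f ≡ sumF (λ i → c * f i)
  *-distribˡ-sumF c f = trans (cong (c *_) (sumF≡sum f)) (trans (*-distribˡ-sum c f) (sym (sumF≡sum (λ i → c * f i))))

  *-distribʳ-sumF : ∀ {n} c (f : Fin n → ℕ) → sumF f * c ≡ sumF (λ i → f i * c)
  *-distribʳ-sumF c f = trans (cong (_* c) (sumF≡sum f)) (trans (*-distribʳ-sum c f) (sym (sumF≡sum (λ i → f i * c))))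

  sumF-const : ∀ {n} c → sumF {n} (λ _ → c) ≡ n * c
  sumF-const {zero}  c = refl
  sumF-const {suc n} c = cong (c +_) (sumF-const {n} c)

  sumF-comm : ∀ {m n} (f : Fin m → Fin n → ℕ) →
    sumF (λ i → sumF (f i)) ≡ sumF (λ j → sumF (λ i → f i j))
  sumF-comm f = trans (nested f) (trans (∑-comm f) (sym (nested (λ j i → f i j))))
    where
    nested : ∀ {m n} (g : Fin m → Fin n → ℕ) → sumF (λ i → sumF (g i)) ≡ sum (λ i → sum (g i))
    nested g = trans (sumF≡sum (λ i → sumF (g i))) (sum-cong-≗ (λ i → sumF≡sum (g i)))

  count≡sumF : ∀ {n} (P : Fin n → Bool) → count P ≡ sumF (λ i → ⟦ P i ⟧)
  count≡sumF {zero}  P = refl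
  count≡sumF {suc n} P = cong (⟦ P zero ⟧ +_) (count≡sumF (P ∘ suc))

  count-const : ∀ {n} b → count {n} (λ _ → b) ≡ n * ⟦ b ⟧
  count-const {n} b = trans (count≡sumF {n} (λ _ → b)) (sumF-const {n} ⟦ b ⟧)

  count-∧ˡ : ∀ {n} b (P : Fin n → Bool) → count (λ i → b ∧ P i) ≡ ⟦ b ⟧ * count P
  count-∧ˡ true  P = sym (+-identityʳ (count P))
  count-∧ˡ {n} false P = trans (count-const {n} false) (*-zeroʳ n)

  T-∧⁻ : ∀ {x y} → T (x ∧ y) → T x × T y
  T-∧⁻ = Equivalence.to T-∧

  ⟦⟧-weight : ∀ b {x y} → (T b → x ≤ y) → ⟦ b ⟧ * x ≤ ⟦ b ⟧ * y
  ⟦⟧-weight true  x≤y = +-monoˡ-≤ 0 (x≤y _)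
  ⟦⟧-weight false _   = z≤n

  ⟦⟧-weight-≤ : ∀ b {x y} → (T b → x ≤ y) → ⟦ b ⟧ * x ≤ y
  ⟦⟧-weight-≤ true  x≤y = ≤-trans (≤-reflexive (+-identityʳ _)) (x≤y _)
  ⟦⟧-weight-≤ false _   = z≤n

  ⟦∧⟧-weight : ∀ a b {x y} → (T b → x ≤ y) → ⟦ a ∧ b ⟧ * x ≤ ⟦ a ⟧ * y
  ⟦∧⟧-weight true  b x≤y = ≤-trans (⟦⟧-weight-≤ b x≤y) (≤-reflexive (sym (+-identityʳ _)))
  ⟦∧⟧-weight false b _   = z≤n

  Σ² : ∀ {n} → (Fin n → Fin n → ℕ) → ℕ
  Σ² f = sumF λ x → sumF λ y → f x y

  Σ²-cong : ∀ {n} {f g : Fin n → Fin n → ℕ} → (∀ x y → f x y ≡ g x y) → Σ² f ≡ Σ² g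
  Σ²-cong f≗g = sumF-cong (λ x → sumF-cong (f≗g x))

  Σ²-mono-≤ : ∀ {n} {f g : Fin n → Fin n → ℕ} → (∀ x y → f x y ≤ g x y) → Σ² f ≤ Σ² g
  Σ²-mono-≤ f≤g = sumF-mono-≤ (λ x → sumF-mono-≤ (f≤g x))

  Σ²-distrib-+ : ∀ {n} (f g : Fin n → Fin n → ℕ) → Σ² (λ x y → f x y + g x y) ≡ Σ² f + Σ² g
  Σ²-distrib-+ f g =
    trans (sumF-cong (λ x → sumF-distrib-+ (f x) (g x))) (sumF-distrib-+ (λ x → sumF (f x)) (λ x → sumF (g x)))

  *-distribˡ-Σ² : ∀ {n} c (f : Fin n → Fin n → ℕ) → c * Σ² f ≡ Σ² (λ x y → c * f x y)
  *-distribˡ-Σ² c f = trans (*-distribˡ-sumF c (λ x → sumF (f x))) (sumF-cong (λ x → *-distribˡ-sumF c (f x)))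

  *-distribʳ-Σ² : ∀ {n} c (f : Fin n → Fin n → ℕ) → Σ² f * c ≡ Σ² (λ x y → f x y * c)
  *-distribʳ-Σ² c f = trans (*-distribʳ-sumF c (λ x → sumF (f x))) (sumF-cong (λ x → *-distribʳ-sumF c (f x)))

  Σ²-transpose : ∀ {n} (f : Fin n → Fin n → ℕ) → Σ² (λ x y → f y x) ≡ Σ² f
  Σ²-transpose f = sumF-comm (λ x y → f y x)

  Σ²-const : ∀ {n} c → Σ² {n} (λ _ _ → c) ≡ n * (n * c)
  Σ²-const {n} c = trans (sumF-cong {n} (λ _ → sumF-const {n} c)) (sumF-const {n} (n * c))

  Σ²-const₁ : ∀ {n} (h : Fin n → ℕ) → Σ² (λ _ y → h y) ≡ n * sumF h
  Σ²-const₁ {n} h = sumF-const {n} (sumF h)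

  Σ²-const₂ : ∀ {n} (h : Fin n → ℕ) → Σ² (λ x _ → h x) ≡ n * sumF h
  Σ²-const₂ {n} h = trans (sumF-cong (λ x → sumF-const {n} (h x))) (sym (*-distribˡ-sumF n h))

  Σ⁴ : ∀ {n} → (Fin n → Fin n → Fin n → Fin n → ℕ) → ℕ
  Σ⁴ f = Σ² λ x y → Σ² λ z w → f x y z w

  Σ⁴-mono-≤ : ∀ {n} {f g : Fin n → Fin n → Fin n → Fin n → ℕ} →
    (∀ x y z w → f x y z w ≤ g x y z w) → Σ⁴ f ≤ Σ⁴ g
  Σ⁴-mono-≤ f≤g = Σ²-mono-≤ (λ x y → Σ²-mono-≤ (f≤g x y))

  Σ⁴-distrib-+ : ∀ {n} (f g : Fin n → Fin n → Fin n → Fin n → ℕ) →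
    Σ⁴ (λ x y z w → f x y z w + g x y z w) ≡ Σ⁴ f + Σ⁴ g
  Σ⁴-distrib-+ f g = trans (Σ²-cong (λ x y → Σ²-distrib-+ (f x y) (g x y))) (Σ²-distrib-+ (λ x y → Σ² (f x y)) (λ x y → Σ² (g x y)))

  Σ⁴-xy : ∀ {n} (g : Fin n → Fin n → ℕ) → Σ⁴ (λ x y z w → g x y) ≡ n * (n * Σ² g)
  Σ⁴-xy {n} g = trans (Σ²-cong (λ x y → Σ²-const {n} (g x y)))
    (sym (trans (cong (n *_) (*-distribˡ-Σ² n g)) (*-distribˡ-Σ² n (λ x y → n * g x y))))

  Σ⁴-zw : ∀ {n} (g : Fin n → Fin n → ℕ) → Σ⁴ (λ x y z w → g z w) ≡ n * (n * Σ² g)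
  Σ⁴-zw {n} g = Σ²-const {n} (Σ² g)

  Σ⁴-yz : ∀ {n} (g : Fin n → Fin n → ℕ) → Σ⁴ (λ x y z w → g y z) ≡ n * (n * Σ² g)
  Σ⁴-yz {n} g = trans (Σ²-cong (λ x y → Σ²-const₂ (g y)))
    (trans (Σ²-const₁ (λ y → n * sumF (g y))) (cong (n *_) (sym (*-distribˡ-sumF n (λ y → sumF (g y))))))

  Σ⁴-xz : ∀ {n} (g : Fin n → Fin n → ℕ) → Σ⁴ (λ x y z w → g x z) ≡ n * (n * Σ² g)
  Σ⁴-xz {n} g = trans (Σ²-cong (λ x y → Σ²-const₂ (g x)))
    (trans (Σ²-const₂ (λ x → n * sumF (g x))) (cong (n *_) (sym (*-distribˡ-sumF n (λ x → sumF (g x))))))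

  Σ⁴-yw : ∀ {n} (g : Fin n → Fin n → ℕ) → Σ⁴ (λ x y z w → g y w) ≡ n * (n * Σ² g)
  Σ⁴-yw {n} g = trans (Σ²-cong (λ x y → Σ²-const₁ (g y)))
    (trans (Σ²-const₁ (λ y → n * sumF (g y))) (cong (n *_) (sym (*-distribˡ-sumF n (λ y → sumF (g y))))))

module Counting where

  open import Defs
  open Sums
  open import Data.Bool.Base using (Bool; true; false; _∧_; not; T)
  open import Data.Product using (proj₁; proj₂)
  open import Data.Fin.Base using (Fin; toℕ)
  open import Data.Nat.Base using (ℕ; zero; suc; _+_; _*_; _∸_; _^_; _≤_; _<_; z≤n; s≤s; NonZero)
  open import Data.Nat.Combinatorics using (_C_; nCk+nC[k+1]≡[n+1]C[k+1]; nC1≡n)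
  open import Data.Nat.Properties
  open import Algebra.Properties.CommutativeSemigroup *-commutativeSemigroup using (x∙yz≈y∙xz)
  open import Data.Rational.Base using (ℚ)
  open import Relation.Nullary.Decidable using (Dec; yes; no; ⌊_⌋; toWitness; toWitnessFalse)
  open import Relation.Nullary.Negation using (contradiction)
  open import Relation.Binary.PropositionalEquality
  open import Data.Nat.Tactic.RingSolver using (solve-∀)

  edge-reverse : ∀ {n} (H : 3Graph n) x y z → edge H x y z ≡ edge H z y x
  edge-reverse H x y z = trans (swap₁₂ H x y z) (trans (swap₂₃ H y x z) (swap₁₂ H y z x))

  light : ∀ {n} → 3Graph n → ℚ → Fin n → Fin n → Bool
  light H β x y = not (heavy H β x y)

  #light : ∀ {n} → 3Graph n → ℚ → ℕ
  #light H β = Σ² λ x y → ⟦ light H β x y ⟧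

  #absorbers≡Σ⁴ : ∀ {n} (H : 3Graph n) β v → #absorbers H β v ≡ Σ⁴ λ x y z w → ⟦ isAbsorber H β v x y z w ⟧
  #absorbers≡Σ⁴ {n} H β v = Σ²-cong λ x y → sumF-cong {n} λ z → count≡sumF (isAbsorber H β v x y z)

  -- (ρ,d)-cherry-density for d = p / q and ρ ≤ 1 / (q K), multiplied through by q K.
  CherryDenseℕ : ∀ {n} → ℕ → ℕ → ℕ → 3Graph n → Set
  CherryDenseℕ {n} p q K H = ∀ G₁ G₂ → p * K * |P₂| G₁ G₂ ≤ q * K * e[ H ] G₁ G₂ + n ^ 3

  -- With α = a / b and d = p / q: once there are at most n² / M b q light pairs, they spoil at most
  -- 6 n⁴ / M b q = n⁴ / (512 b³ q²) ≤ α³ d² n⁴ / 512 pre-absorbers, half of the α³ d² n⁴ / 256 found.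
  M : ℕ → ℕ → ℕ
  M b q = 3072 * (b * b * b) * (q * q)

  M≢0 : ∀ b q .{{_ : NonZero b}} .{{_ : NonZero q}} → NonZero (M b q)
  M≢0 b q = m*n≢0 (3072 * (b * b * b)) (q * q) {{m*n≢0 3072 (b * b * b) {{_}} {{m*n≢0 (b * b) b {{m*n≢0 b b}}}}}} {{m*n≢0 q q}}

  ⟦<⟧+⟦>⟧≤1 : ∀ {i j} (i<?j : Dec (i < j)) (j<?i : Dec (j < i)) l → ⟦ ⌊ i<?j ⌋ ∧ l ⟧ + ⟦ ⌊ j<?i ⌋ ∧ l ⟧ ≤ ⟦ l ⟧
  ⟦<⟧+⟦>⟧≤1 (yes i<j) (yes j<i) l     = contradiction j<i (<-asym i<j)
  ⟦<⟧+⟦>⟧≤1 (yes _)   (no _)    l     = ≤-reflexive (+-identityʳ ⟦ l ⟧)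
  ⟦<⟧+⟦>⟧≤1 (no _)    (yes _)   l     = ≤-refl
  ⟦<⟧+⟦>⟧≤1 (no _)    (no _)    l     = z≤n

  preAbsorber≤absorber+light : ∀ (l₁ l₂ l₃ e₁ e₂ h₁ h₂ h₃ h₄ h₅ h₆ : Bool) →
    ⟦ (l₁ ∧ e₁) ∧ l₂ ∧ (l₃ ∧ e₂) ⟧ ≤
    ⟦ e₁ ∧ e₂ ∧ l₁ ∧ l₂ ∧ l₃ ∧ (e₁ ∧ h₁ ∧ h₂ ∧ h₃) ∧ (e₂ ∧ h₄ ∧ h₅ ∧ h₆) ⟧ +
    (⟦ not h₁ ⟧ + (⟦ not h₂ ⟧ + (⟦ not h₃ ⟧ + (⟦ not h₄ ⟧ + (⟦ not h₅ ⟧ + ⟦ not h₆ ⟧)))))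
  preAbsorber≤absorber+light false _    _     _     _     _     _     _     _     _     _     = z≤n
  preAbsorber≤absorber+light true  _    _     false _     _     _     _     _     _     _     = z≤n
  preAbsorber≤absorber+light true  false _    true  _     _     _     _     _     _     _     = z≤n
  preAbsorber≤absorber+light true  true false true  _     _     _     _     _     _     _     = z≤n
  preAbsorber≤absorber+light true  true true  true  false _     _     _     _     _     _     = z≤n
  preAbsorber≤absorber+light true  true true  true  true  false _     _     _     _     _     = s≤s z≤n
  preAbsorber≤absorber+light true  true true  true  true  true  false _     _     _     _     = s≤s z≤n
  preAbsorber≤absorber+light true  true true  true  true  true  true  false _     _     _     = s≤s z≤n
  preAbsorber≤absorber+light true  true true  true  true  true  true  true  false _     _     = s≤s z≤n
  preAbsorber≤absorber+light true  true true  true  true  true  true  true  true  false _     = s≤s z≤n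
  preAbsorber≤absorber+light true  true true  true  true  true  true  true  true  true  false = s≤s z≤n
  preAbsorber≤absorber+light true  true true  true  true  true  true  true  true  true  true  = s≤s z≤n

  link-cover : ∀ (l l′ hy hz ly lz : Bool) → l ≡ l′ →
    ⟦ l ⟧ ≤ ⟦ l ∧ (hy ∧ hz) ∧ (not ly ∧ not lz) ⟧ + ⟦ not hy ∧ l ⟧ + ⟦ not hz ∧ l′ ⟧
            + ⟦ l ∧ hz ∧ ly ⟧ + ⟦ l′ ∧ hy ∧ lz ⟧
  link-cover false _    _     _     _     _     _    = z≤n
  link-cover true  true false _     _     _     refl = s≤s z≤n
  link-cover true  true true  false _     _     refl = s≤s z≤n
  link-cover true  true true  true  true  _     refl = s≤s z≤n
  link-cover true  true true  true  false true  refl = s≤s z≤n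
  link-cover true  true true  true  false false refl = s≤s z≤n

  2*[m]C2≡m*[m∸1] : ∀ m → 2 * (m C 2) ≡ m * (m ∸ 1)
  2*[m]C2≡m*[m∸1] zero          = refl
  2*[m]C2≡m*[m∸1] (suc zero)    = refl
  2*[m]C2≡m*[m∸1] (suc (suc k)) = begin
    2 * (suc (suc k) C 2)         ≡⟨ cong (2 *_) (nCk+nC[k+1]≡[n+1]C[k+1] (suc k) 1) ⟨
    2 * (suc k C 1 + suc k C 2)   ≡⟨ cong (λ t → 2 * (t + suc k C 2)) (nC1≡n (suc k)) ⟩
    2 * (suc k + suc k C 2)       ≡⟨ *-distribˡ-+ 2 (suc k) _ ⟩
    2 * suc k + 2 * (suc k C 2)   ≡⟨ cong (2 * suc k +_) (2*[m]C2≡m*[m∸1] (suc k)) ⟩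
    2 * suc k + suc k * k         ≡⟨ solve-∀′ k ⟩
    suc (suc k) * suc k           ∎
    where
    open ≡-Reasoning
    solve-∀′ : ∀ k → 2 * suc k + suc k * k ≡ suc (suc k) * suc k
    solve-∀′ = solve-∀

  7n²≤8[n∸1][n∸2] : ∀ {n} → 24 ≤ n → 7 * (n * n) ≤ 8 * ((n ∸ 1) * (n ∸ 2))
  7n²≤8[n∸1][n∸2] {n} 24≤n = subst (λ k → 7 * (k * k) ≤ 8 * ((k ∸ 1) * (k ∸ 2))) (m+[n∸m]≡n 24≤n) (expanded (n ∸ 24))
    where
    expanded : ∀ m → 7 * ((24 + m) * (24 + m)) ≤ 8 * ((23 + m) * (22 + m))
    expanded m = ≤-trans (m≤m+n _ (16 + 24 * m + m * m)) (≤-reflexive (identity m))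
      where
      identity : ∀ m → 7 * ((24 + m) * (24 + m)) + (16 + 24 * m + m * m) ≡ 8 * ((23 + m) * (22 + m))
      identity = solve-∀

  module Link {n : ℕ} (H : 3Graph n) (v : Fin n) where

    link : Fin n → Fin n → Bool
    link = edge H v

    link-sym : ∀ y z → link y z ≡ link z y
    link-sym = swap₂₃ H v

    linkDeg : Fin n → ℕ
    linkDeg y = count (link y)

    ext : Fin n → Fin n → ℕ
    ext y z = count λ w → link z w ∧ edge H y z w

    #linkPairs : ℕ
    #linkPairs = Σ² λ y z → ⟦ link y z ⟧

    |P₂|-link : ∀ G → |P₂| G link ≡ Σ² λ y z → ⟦ G y z ⟧ * linkDeg z
    |P₂|-link G = Σ²-cong λ y z → count-∧ˡ {n} (G y z) (link z)

    e-link : ∀ G → e[ H ] G link ≡ Σ² λ y z → ⟦ G y z ⟧ * ext y z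
    e-link G = Σ²-cong λ y z → count-∧ˡ {n} (G y z) (λ w → link z w ∧ edge H y z w)

    deg+deg≤#linkPairs : deg H v + deg H v ≤ #linkPairs
    deg+deg≤#linkPairs = begin
      deg H v + deg H v
        ≡⟨ cong₂ _+_ deg≡ (trans deg≡ (sym (Σ²-transpose (λ x y → ⟦ x<y x y ∧ link x y ⟧)))) ⟩
      Σ² (λ x y → ⟦ x<y x y ∧ link x y ⟧) + Σ² (λ x y → ⟦ x<y y x ∧ link y x ⟧)
        ≡⟨ Σ²-distrib-+ {n} _ _ ⟨
      Σ² (λ x y → ⟦ x<y x y ∧ link x y ⟧ + ⟦ x<y y x ∧ link y x ⟧)
        ≤⟨ Σ²-mono-≤ (λ x y → subst (λ l → ⟦ x<y x y ∧ link x y ⟧ + ⟦ x<y y x ∧ l ⟧ ≤ ⟦ link x y ⟧)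
                                (link-sym x y) (⟦<⟧+⟦>⟧≤1 (toℕ x <? toℕ y) (toℕ y <? toℕ x) (link x y))) ⟩
      #linkPairs ∎
      where
      open ≤-Reasoning
      x<y : Fin n → Fin n → Bool
      x<y x y = ⌊ toℕ x <? toℕ y ⌋
      deg≡ : deg H v ≡ Σ² (λ x y → ⟦ x<y x y ∧ link x y ⟧)
      deg≡ = sumF-cong {n} λ x → count≡sumF (λ y → x<y x y ∧ link x y)

    -- the conditions of a (β,v)-absorber that do not involve H_β
    isPreAbsorber : Fin n → Fin n → Fin n → Fin n → Bool
    isPreAbsorber x y z w = (link x y ∧ edge H x y z) ∧ link y z ∧ (link z w ∧ edge H y z w)

    #preAbsorbers : ℕ
    #preAbsorbers = Σ⁴ λ x y z w → ⟦ isPreAbsorber x y z w ⟧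

    #preAbsorbers≡ : #preAbsorbers ≡ Σ² λ y z → ⟦ link y z ⟧ * (ext z y * ext y z)
    #preAbsorbers≡ = begin
      #preAbsorbers
        ≡⟨ Σ²-cong (λ x y → sumF-cong {n} λ z → sum-over-w x y z) ⟩
      sumF (λ x → sumF λ y → sumF λ z → ⟦ start x y z ⟧ * (⟦ link y z ⟧ * ext y z))
        ≡⟨ sumF-comm {n} {n} _ ⟩
      sumF (λ y → sumF λ x → sumF λ z → ⟦ start x y z ⟧ * (⟦ link y z ⟧ * ext y z))
        ≡⟨ sumF-cong {n} (λ y → sumF-comm {n} {n} _) ⟩
      Σ² (λ y z → sumF λ x → ⟦ start x y z ⟧ * (⟦ link y z ⟧ * ext y z))
        ≡⟨ Σ²-cong (λ y z → sum-over-x y z) ⟩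
      Σ² (λ y z → ⟦ link y z ⟧ * (ext z y * ext y z)) ∎
      where
      open ≡-Reasoning
      start : Fin n → Fin n → Fin n → Bool
      start x y z = link x y ∧ edge H x y z
      sum-over-w : ∀ x y z → sumF (λ w → ⟦ isPreAbsorber x y z w ⟧) ≡ ⟦ start x y z ⟧ * (⟦ link y z ⟧ * ext y z)
      sum-over-w x y z = begin
        sumF (λ w → ⟦ isPreAbsorber x y z w ⟧) ≡⟨ count≡sumF (isPreAbsorber x y z) ⟨
        count (isPreAbsorber x y z) ≡⟨ count-∧ˡ {n} (start x y z) _ ⟩
        ⟦ start x y z ⟧ * count (λ w → link y z ∧ (link z w ∧ edge H y z w))
          ≡⟨ cong (⟦ start x y z ⟧ *_) (count-∧ˡ {n} (link y z) _) ⟩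
        ⟦ start x y z ⟧ * (⟦ link y z ⟧ * ext y z) ∎
      sum-over-x : ∀ y z → sumF (λ x → ⟦ start x y z ⟧ * (⟦ link y z ⟧ * ext y z)) ≡ ⟦ link y z ⟧ * (ext z y * ext y z)
      sum-over-x y z = begin
        sumF (λ x → ⟦ start x y z ⟧ * (⟦ link y z ⟧ * ext y z)) ≡⟨ *-distribʳ-sumF {n} _ _ ⟨
        sumF (λ x → ⟦ start x y z ⟧) * (⟦ link y z ⟧ * ext y z)
          ≡⟨ cong (_* (⟦ link y z ⟧ * ext y z)) (trans (sumF-cong reversed) (sym (count≡sumF (λ x → link y x ∧ edge H z y x)))) ⟩
        ext z y * (⟦ link y z ⟧ * ext y z) ≡⟨ x∙yz≈y∙xz (ext z y) ⟦ link y z ⟧ (ext y z) ⟩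
        ⟦ link y z ⟧ * (ext z y * ext y z) ∎
        where
        reversed : ∀ x → ⟦ start x y z ⟧ ≡ ⟦ link y x ∧ edge H z y x ⟧
        reversed x = cong₂ (λ l e → ⟦ l ∧ e ⟧) (link-sym x y) (edge-reverse H x y z)

    #preAbsorbers≤#absorbers+#light : ∀ β → #preAbsorbers ≤ #absorbers H β v + 6 * (n * (n * #light H β))
    #preAbsorbers≤#absorbers+#light β = begin
      #preAbsorbers
        ≤⟨ Σ⁴-mono-≤ (λ x y z w → preAbsorber≤absorber+light (link x y) (link y z) (link z w) (edge H x y z) (edge H y z w)
             (heavy H β x y) (heavy H β y z) (heavy H β x z) (heavy H β y z) (heavy H β z w) (heavy H β y w)) ⟩
      Σ⁴ (λ x y z w → ⟦ isAbsorber H β v x y z w ⟧ + (l x y + (l y z + (l x z + (l y z + (l z w + l y w))))))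
        ≡⟨ Σ⁴-distrib-+ {n} _ _ ⟩
      Σ⁴ (λ x y z w → ⟦ isAbsorber H β v x y z w ⟧) + Σ⁴ (λ x y z w → l x y + (l y z + (l x z + (l y z + (l z w + l y w)))))
        ≡⟨ cong₂ _+_ (sym (#absorbers≡Σ⁴ H β v)) six-pairs ⟩
      #absorbers H β v + 6 * L ∎
      where
      open ≤-Reasoning
      l : Fin n → Fin n → ℕ
      l x y = ⟦ light H β x y ⟧
      L = n * (n * #light H β)
      six-pairs : Σ⁴ (λ x y z w → l x y + (l y z + (l x z + (l y z + (l z w + l y w))))) ≡ 6 * L
      six-pairs = trans by-pair (sum-of-six L)
        where
        sum-of-six : ∀ m → m + (m + (m + (m + (m + m)))) ≡ 6 * m
        sum-of-six = solve-∀
        by-pair : Σ⁴ (λ x y z w → l x y + (l y z + (l x z + (l y z + (l z w + l y w))))) ≡ L + (L + (L + (L + (L + L))))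
        by-pair =
          trans (Σ⁴-distrib-+ {n} _ _) (cong₂ _+_ (Σ⁴-xy l)
          (trans (Σ⁴-distrib-+ {n} _ _) (cong₂ _+_ (Σ⁴-yz l)
          (trans (Σ⁴-distrib-+ {n} _ _) (cong₂ _+_ (Σ⁴-xz l)
          (trans (Σ⁴-distrib-+ {n} _ _) (cong₂ _+_ (Σ⁴-yz l)
          (trans (Σ⁴-distrib-+ {n} _ _) (cong₂ _+_ (Σ⁴-zw l) (Σ⁴-yw l))))))))))

    -- With α = a / b and d = p / q: highDeg y iff linkDeg y ≥ α n / 4, and fewExt y z iff ext y z < α d n / 8.
    module Thresholds (a b p q : ℕ) where

      highDeg : Fin n → Bool
      highDeg y = ⌊ a * n ≤? 4 * b * linkDeg y ⌋

      fewExt : Fin n → Fin n → Bool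
      fewExt y z = ⌊ 8 * b * q * ext y z <? a * p * n ⌋

      bad : Fin n → Fin n → Bool
      bad y z = link y z ∧ highDeg z ∧ fewExt y z

      good : Fin n → Fin n → Bool
      good y z = link y z ∧ (highDeg y ∧ highDeg z) ∧ (not (fewExt y z) ∧ not (fewExt z y))

      #bad #good #lowDegLinkPairs : ℕ
      #bad = Σ² λ y z → ⟦ bad y z ⟧
      #good = Σ² λ y z → ⟦ good y z ⟧
      #lowDegLinkPairs = Σ² λ y z → ⟦ not (highDeg y) ∧ link y z ⟧

      highDeg⇒ : ∀ {y} → T (highDeg y) → a * n ≤ 4 * b * linkDeg y
      highDeg⇒ {y} = toWitness {a? = a * n ≤? 4 * b * linkDeg y}

      ¬highDeg⇒ : ∀ {y} → T (not (highDeg y)) → 4 * b * linkDeg y ≤ a * n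
      ¬highDeg⇒ {y} t = <⇒≤ (≰⇒> (toWitnessFalse {a? = a * n ≤? 4 * b * linkDeg y} t))

      fewExt⇒ : ∀ {y z} → T (fewExt y z) → 8 * b * q * ext y z ≤ a * p * n
      fewExt⇒ {y} {z} t = <⇒≤ (toWitness {a? = 8 * b * q * ext y z <? a * p * n} t)

      ¬fewExt⇒ : ∀ {y z} → T (not (fewExt y z)) → a * p * n ≤ 8 * b * q * ext y z
      ¬fewExt⇒ {y} {z} t = ≮⇒≥ (toWitnessFalse {a? = 8 * b * q * ext y z <? a * p * n} t)

      bad⇒highDeg : ∀ {y z} → T (bad y z) → T (highDeg z)
      bad⇒highDeg {y} {z} t = proj₁ (T-∧⁻ {highDeg z} (proj₂ (T-∧⁻ {link y z} t)))

      bad⇒fewExt : ∀ {y z} → T (bad y z) → T (fewExt y z)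
      bad⇒fewExt {y} {z} t = proj₂ (T-∧⁻ {highDeg z} (proj₂ (T-∧⁻ {link y z} t)))

      #linkPairs≤ : #linkPairs ≤ #good + #lowDegLinkPairs + #lowDegLinkPairs + #bad + #bad
      #linkPairs≤ = begin
        #linkPairs
          ≤⟨ Σ²-mono-≤ (λ y z → link-cover (link y z) (link z y) (highDeg y) (highDeg z) (fewExt y z) (fewExt z y) (link-sym y z)) ⟩
        Σ² (λ y z → ⟦ good y z ⟧ + ⟦ not (highDeg y) ∧ link y z ⟧ + ⟦ not (highDeg z) ∧ link z y ⟧ + ⟦ bad y z ⟧ + ⟦ bad z y ⟧)
          ≡⟨ trans (Σ²-distrib-+ {n} _ _) (cong₂ _+_
               (trans (Σ²-distrib-+ {n} _ _) (cong₂ _+_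
                 (trans (Σ²-distrib-+ {n} _ _) (cong₂ _+_
                   (Σ²-distrib-+ {n} _ _)
                   (Σ²-transpose (λ y z → ⟦ not (highDeg y) ∧ link y z ⟧))))
                 refl))
               (Σ²-transpose (λ y z → ⟦ bad y z ⟧))) ⟩
        #good + #lowDegLinkPairs + #lowDegLinkPairs + #bad + #bad ∎
        where open ≤-Reasoning

      #lowDegLinkPairs-bound : 4 * b * #lowDegLinkPairs ≤ n * (a * n)
      #lowDegLinkPairs-bound = begin
        4 * b * #lowDegLinkPairs
          ≡⟨ cong (4 * b *_) (sumF-cong {n} λ y → trans (sym (count≡sumF (λ z → not (highDeg y) ∧ link y z)))
                                                          (count-∧ˡ (not (highDeg y)) (link y))) ⟩
        4 * b * sumF (λ y → ⟦ not (highDeg y) ⟧ * linkDeg y) ≡⟨ *-distribˡ-sumF {n} (4 * b) _ ⟩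
        sumF (λ y → 4 * b * (⟦ not (highDeg y) ⟧ * linkDeg y))
          ≤⟨ sumF-mono-≤ (λ y → ≤-trans (≤-reflexive (x∙yz≈y∙xz (4 * b) ⟦ not (highDeg y) ⟧ (linkDeg y)))
                                          (⟦⟧-weight-≤ (not (highDeg y)) ¬highDeg⇒)) ⟩
        sumF {n} (λ _ → a * n) ≡⟨ sumF-const {n} (a * n) ⟩
        n * (a * n) ∎
        where open ≤-Reasoning

      #bad-bound : ∀ K .{{_ : NonZero n}} → CherryDenseℕ p q K H → a * p * K * #bad ≤ 8 * b * (n * n)
      #bad-bound K cherry = *-cancelʳ-≤ _ _ n (double-count enough-paths few-extensions (cherry bad link))
        where
        P = |P₂| bad link
        e = e[ H ] bad link
        enough-paths : a * n * #bad ≤ 4 * b * P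
        enough-paths = begin
          a * n * #bad ≡⟨ *-distribˡ-Σ² {n} (a * n) _ ⟩
          Σ² (λ y z → a * n * ⟦ bad y z ⟧)
            ≤⟨ Σ²-mono-≤ (λ y z → ≤-trans (≤-reflexive (*-comm (a * n) _)) (⟦⟧-weight (bad y z) (λ t → highDeg⇒ (bad⇒highDeg t)))) ⟩
          Σ² (λ y z → ⟦ bad y z ⟧ * (4 * b * linkDeg z)) ≡⟨ Σ²-cong (λ y z → x∙yz≈y∙xz ⟦ bad y z ⟧ (4 * b) _) ⟩
          Σ² (λ y z → 4 * b * (⟦ bad y z ⟧ * linkDeg z)) ≡⟨ *-distribˡ-Σ² {n} (4 * b) _ ⟨
          4 * b * Σ² (λ y z → ⟦ bad y z ⟧ * linkDeg z) ≡⟨ cong (4 * b *_) (|P₂|-link bad) ⟨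
          4 * b * P ∎
          where open ≤-Reasoning
        few-extensions : 8 * b * q * e ≤ a * p * n * #bad
        few-extensions = begin
          8 * b * q * e ≡⟨ cong (8 * b * q *_) (e-link bad) ⟩
          8 * b * q * Σ² (λ y z → ⟦ bad y z ⟧ * ext y z) ≡⟨ *-distribˡ-Σ² {n} (8 * b * q) _ ⟩
          Σ² (λ y z → 8 * b * q * (⟦ bad y z ⟧ * ext y z)) ≡⟨ Σ²-cong (λ y z → x∙yz≈y∙xz (8 * b * q) ⟦ bad y z ⟧ _) ⟩
          Σ² (λ y z → ⟦ bad y z ⟧ * (8 * b * q * ext y z))
            ≤⟨ Σ²-mono-≤ (λ y z → ≤-trans (⟦⟧-weight (bad y z) (λ t → fewExt⇒ (bad⇒fewExt t))) (≤-reflexive (*-comm _ (a * p * n)))) ⟩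
          Σ² (λ y z → a * p * n * ⟦ bad y z ⟧) ≡⟨ *-distribˡ-Σ² {n} (a * p * n) _ ⟨
          a * p * n * #bad ∎
          where open ≤-Reasoning
        double-count : ∀ {B P e} → a * n * B ≤ 4 * b * P → 8 * b * q * e ≤ a * p * n * B →
          p * K * P ≤ q * K * e + n ^ 3 → a * p * K * B * n ≤ 8 * b * (n * n) * n
        double-count {B} {P} {e} h₁ h₂ h₃ = +-cancelˡ-≤ X _ _ (begin
          X + X ≡⟨ e₁ a p K B n ⟩
          2 * p * K * (a * n * B) ≤⟨ *-monoʳ-≤ (2 * p * K) h₁ ⟩
          2 * p * K * (4 * b * P) ≡⟨ e₂ p K b P ⟩
          8 * b * (p * K * P) ≤⟨ *-monoʳ-≤ (8 * b) h₃ ⟩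
          8 * b * (q * K * e + n ^ 3) ≡⟨ e₃ b q K e n ⟩
          K * (8 * b * q * e) + 8 * b * (n * n) * n ≤⟨ +-monoˡ-≤ _ (*-monoʳ-≤ K h₂) ⟩
          K * (a * p * n * B) + 8 * b * (n * n) * n ≡⟨ cong (_+ 8 * b * (n * n) * n) (e₄ K a p n B) ⟩
          X + 8 * b * (n * n) * n ∎)
          where
          open ≤-Reasoning
          X = a * p * K * B * n
          e₁ : ∀ a p K B n → a * p * K * B * n + a * p * K * B * n ≡ 2 * p * K * (a * n * B)
          e₁ = solve-∀
          e₂ : ∀ p K b P → 2 * p * K * (4 * b * P) ≡ 8 * b * (p * K * P)
          e₂ = solve-∀
          e₃ : ∀ b q K e n → 8 * b * (q * K * e + n * (n * (n * 1))) ≡ K * (8 * b * q * e) + 8 * b * (n * n) * n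
          e₃ = solve-∀
          e₄ : ∀ K a p n B → K * (a * p * n * B) ≡ a * p * K * B * n
          e₄ = solve-∀

      good⇒preAbsorbers : #good * (a * p * n * (a * p * n)) ≤ 8 * b * q * (8 * b * q) * #preAbsorbers
      good⇒preAbsorbers = begin
        #good * (a * p * n * (a * p * n)) ≡⟨ *-distribʳ-Σ² {n} _ _ ⟩
        Σ² (λ y z → ⟦ good y z ⟧ * (a * p * n * (a * p * n)))
          ≤⟨ Σ²-mono-≤ (λ y z → ⟦∧⟧-weight (link y z) ((highDeg y ∧ highDeg z) ∧ (not (fewExt y z) ∧ not (fewExt z y)))
                                            (both-extensions-large y z)) ⟩
        Σ² (λ y z → ⟦ link y z ⟧ * (8 * b * q * ext z y * (8 * b * q * ext y z)))
          ≡⟨ Σ²-cong (λ y z → rearrange (8 * b * q) ⟦ link y z ⟧ (ext z y) (ext y z)) ⟩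
        Σ² (λ y z → 8 * b * q * (8 * b * q) * (⟦ link y z ⟧ * (ext z y * ext y z)))
          ≡⟨ *-distribˡ-Σ² {n} (8 * b * q * (8 * b * q)) _ ⟨
        8 * b * q * (8 * b * q) * Σ² (λ y z → ⟦ link y z ⟧ * (ext z y * ext y z))
          ≡⟨ cong (8 * b * q * (8 * b * q) *_) #preAbsorbers≡ ⟨
        8 * b * q * (8 * b * q) * #preAbsorbers ∎
        where
        open ≤-Reasoning
        both-extensions-large : ∀ y z → T ((highDeg y ∧ highDeg z) ∧ (not (fewExt y z) ∧ not (fewExt z y))) →
          a * p * n * (a * p * n) ≤ 8 * b * q * ext z y * (8 * b * q * ext y z)
        both-extensions-large y z t = *-mono-≤ (¬fewExt⇒ (proj₂ many-ext)) (¬fewExt⇒ (proj₁ many-ext))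
          where many-ext = T-∧⁻ {not (fewExt y z)} (proj₂ (T-∧⁻ {highDeg y ∧ highDeg z} t))
        rearrange : ∀ c l e e′ → l * (c * e * (c * e′)) ≡ c * c * (l * (e * e′))
        rearrange = solve-∀

      module _ .{{_ : NonZero a}} .{{_ : NonZero b}} .{{_ : NonZero p}} .{{_ : NonZero q}} .{{_ : NonZero n}}
               (cherry : CherryDenseℕ p q (M b q) H) where

        128b²≤M : 128 * (b * b) ≤ M b q
        128b²≤M = ≤-trans (m≤m*n (128 * (b * b)) (24 * b * (q * q)) {{24bq²≢0}}) (≤-reflexive (factor b q))
          where
          24bq²≢0 : NonZero (24 * b * (q * q))
          24bq²≢0 = m*n≢0 (24 * b) (q * q) {{m*n≢0 24 b}} {{m*n≢0 q q}}
          factor : ∀ b q → 128 * (b * b) * (24 * b * (q * q)) ≡ 3072 * (b * b * b) * (q * q)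
          factor = solve-∀

        16b#bad≤an² : 16 * b * #bad ≤ a * (n * n)
        16b#bad≤an² = *-cancelˡ-≤ (a * p * M b q) {{apM≢0}} (begin
          a * p * M b q * (16 * b * #bad)  ≡⟨ e₁ a p (M b q) b #bad ⟩
          16 * b * (a * p * M b q * #bad)  ≤⟨ *-monoʳ-≤ (16 * b) (#bad-bound (M b q) cherry) ⟩
          16 * b * (8 * b * (n * n))   ≡⟨ e₂ b n ⟩
          128 * (b * b) * (n * n)      ≤⟨ *-monoˡ-≤ (n * n) 128b²≤M ⟩
          M b q * (n * n)                  ≤⟨ m≤n*m (M b q * (n * n)) (a * a * p) {{a²p≢0}} ⟩
          a * a * p * (M b q * (n * n))    ≡⟨ e₃ a p (M b q) n ⟩
          a * p * M b q * (a * (n * n))    ∎)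
          where
          open ≤-Reasoning
          a²p≢0 : NonZero (a * a * p)
          a²p≢0 = m*n≢0 (a * a) p {{m*n≢0 a a}}
          apM≢0 : NonZero (a * p * M b q)
          apM≢0 = m*n≢0 (a * p) (M b q) {{m*n≢0 a p}} {{M≢0 b q}}
          e₁ : ∀ a p M b B → a * p * M * (16 * b * B) ≡ 16 * b * (a * p * M * B)
          e₁ = solve-∀
          e₂ : ∀ b n → 16 * b * (8 * b * (n * n)) ≡ 128 * (b * b) * (n * n)
          e₂ = solve-∀
          e₃ : ∀ a p M n → a * a * p * (M * (n * n)) ≡ a * p * M * (a * (n * n))
          e₃ = solve-∀

        #good-bound : 24 ≤ n → a * ((n ∸ 1) C 2) ≤ b * deg H v → a * (n * n) ≤ 4 * b * #good
        #good-bound 24≤n min-deg = *-cancelˡ-≤ 2 (+-cancelʳ-≤ (5 * X) _ _ (begin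
          2 * X + 5 * X ≡⟨ e₁ a n ⟩
          a * (7 * (n * n)) ≤⟨ *-monoʳ-≤ a (7n²≤8[n∸1][n∸2] 24≤n) ⟩
          a * (8 * ((n ∸ 1) * (n ∸ 2))) ≡⟨ cong (λ t → a * (8 * t)) [n∸1][n∸2]≡2C ⟩
          a * (8 * (2 * ((n ∸ 1) C 2))) ≡⟨ e₂ a ((n ∸ 1) C 2) ⟩
          16 * (a * ((n ∸ 1) C 2)) ≤⟨ *-monoʳ-≤ 16 min-deg ⟩
          16 * (b * deg H v) ≡⟨ e₃ b (deg H v) ⟩
          8 * b * (deg H v + deg H v) ≤⟨ *-monoʳ-≤ (8 * b) (≤-trans deg+deg≤#linkPairs #linkPairs≤) ⟩
          8 * b * (G + S + S + B + B) ≡⟨ e₄ b G S B ⟩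
          2 * (4 * b * G) + 4 * (4 * b * S) + 16 * b * B
            ≤⟨ +-mono-≤ (+-monoʳ-≤ (2 * (4 * b * G)) (*-monoʳ-≤ 4 #lowDegLinkPairs-bound)) 16b#bad≤an² ⟩
          2 * (4 * b * G) + 4 * (n * (a * n)) + a * (n * n) ≡⟨ e₅ b G a n ⟩
          2 * (4 * b * G) + 5 * X ∎))
          where
          open ≤-Reasoning
          X = a * (n * n)
          G = #good
          S = #lowDegLinkPairs
          B = #bad
          [n∸1][n∸2]≡2C : (n ∸ 1) * (n ∸ 2) ≡ 2 * ((n ∸ 1) C 2)
          [n∸1][n∸2]≡2C = sym (trans (2*[m]C2≡m*[m∸1] (n ∸ 1)) (cong ((n ∸ 1) *_) (∸-+-assoc n 1 1)))
          e₁ : ∀ a n → 2 * (a * (n * n)) + 5 * (a * (n * n)) ≡ a * (7 * (n * n))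
          e₁ = solve-∀
          e₂ : ∀ a c → a * (8 * (2 * c)) ≡ 16 * (a * c)
          e₂ = solve-∀
          e₃ : ∀ b d → 16 * (b * d) ≡ 8 * b * (d + d)
          e₃ = solve-∀
          e₄ : ∀ b G S B → 8 * b * (G + S + S + B + B) ≡ 2 * (4 * b * G) + 4 * (4 * b * S) + 16 * b * B
          e₄ = solve-∀
          e₅ : ∀ b G a n → 2 * (4 * b * G) + 4 * (n * (a * n)) + a * (n * n) ≡ 2 * (4 * b * G) + 5 * (a * (n * n))
          e₅ = solve-∀

        absorbers-lower-boundℕ : ∀ β → 24 ≤ n → a * ((n ∸ 1) C 2) ≤ b * deg H v → M b q * #light H β ≤ n * n →
          a * a * a * (p * p) * (n * n * n * n) ≤ 512 * (b * b * b) * (q * q) * #absorbers H β v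
        absorbers-lower-boundℕ β 24≤n min-deg few-light = +-cancelʳ-≤ R _ _ (begin
          R + R ≡⟨ e₁ a p n ⟩
          2 * (a * p * n * (a * p * n)) * (a * (n * n)) ≤⟨ *-monoʳ-≤ (2 * (a * p * n * (a * p * n))) (#good-bound 24≤n min-deg) ⟩
          2 * (a * p * n * (a * p * n)) * (4 * b * #good) ≡⟨ e₂ a p n b #good ⟩
          8 * b * (#good * (a * p * n * (a * p * n))) ≤⟨ *-monoʳ-≤ (8 * b) good⇒preAbsorbers ⟩
          8 * b * (8 * b * q * (8 * b * q) * #preAbsorbers) ≡⟨ e₃ b q #preAbsorbers ⟩
          W * #preAbsorbers ≤⟨ *-monoʳ-≤ W (#preAbsorbers≤#absorbers+#light β) ⟩
          W * (Abs + 6 * (n * (n * #light H β))) ≡⟨ e₄ b q Abs n (#light H β) ⟩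
          W * Abs + n * n * (M b q * #light H β) ≤⟨ +-monoʳ-≤ (W * Abs) (*-monoʳ-≤ (n * n) few-light) ⟩
          W * Abs + n * n * (n * n) ≤⟨ +-monoʳ-≤ (W * Abs) n⁴≤R ⟩
          W * Abs + R ∎)
          where
          open ≤-Reasoning
          R = a * a * a * (p * p) * (n * n * n * n)
          W = 512 * (b * b * b) * (q * q)
          Abs = #absorbers H β v
          n⁴≤R : n * n * (n * n) ≤ R
          n⁴≤R = ≤-trans (m≤n*m (n * n * (n * n)) (a * a * a * (p * p)) {{a³p²≢0}}) (≤-reflexive (e₅ a p n))
            where
            a³p²≢0 : NonZero (a * a * a * (p * p))
            a³p²≢0 = m*n≢0 (a * a * a) (p * p) {{m*n≢0 (a * a) a {{m*n≢0 a a}}}} {{m*n≢0 p p}}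
            e₅ : ∀ a p n → a * a * a * (p * p) * (n * n * (n * n)) ≡ a * a * a * (p * p) * (n * n * n * n)
            e₅ = solve-∀
          e₁ : ∀ a p n → a * a * a * (p * p) * (n * n * n * n) + a * a * a * (p * p) * (n * n * n * n)
                         ≡ 2 * (a * p * n * (a * p * n)) * (a * (n * n))
          e₁ = solve-∀
          e₂ : ∀ a p n b G → 2 * (a * p * n * (a * p * n)) * (4 * b * G) ≡ 8 * b * (G * (a * p * n * (a * p * n)))
          e₂ = solve-∀
          e₃ : ∀ b q P → 8 * b * (8 * b * q * (8 * b * q) * P) ≡ 512 * (b * b * b) * (q * q) * P
          e₃ = solve-∀
          e₄ : ∀ b q A n L → 512 * (b * b * b) * (q * q) * (A + 6 * (n * (n * L)))
                             ≡ 512 * (b * b * b) * (q * q) * A + n * n * (3072 * (b * b * b) * (q * q) * L)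
          e₄ = solve-∀

module Rationals where

  open import Defs using (ℕ→ℚ; _^ℚ_)
  open import Data.Integer.Base as ℤ using (+_; +[1+_]; +0; -[1+_])
  import Data.Integer.Properties as ℤ
  open import Data.Integer.Tactic.RingSolver using (solve-∀)
  open import Data.Nat.Base as ℕ using (ℕ; zero; suc)
  open import Data.Nat.Coprimality using (1-coprimeTo) renaming (sym to coprime-sym)
  open import Data.Rational.Base
  open import Data.Rational.Properties
  import Data.Rational.Unnormalised.Base as ℚᵘ
  import Data.Rational.Unnormalised.Properties as ℚᵘ
  open import Relation.Binary.PropositionalEquality
  open import Data.Rational.Solver using (module +-*-Solver)
  open +-*-Solver using (solve; _:+_; _:-_; _:=_)

  ℕ→ℚ≡mkℚ : ∀ k → ℕ→ℚ k ≡ mkℚ (+ k) 0 (coprime-sym (1-coprimeTo k))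
  ℕ→ℚ≡mkℚ k = normalize-coprime (coprime-sym (1-coprimeTo k))

  toℚᵘ-ℕ→ℚ : ∀ k → toℚᵘ (ℕ→ℚ k) ≡ ℚᵘ.mkℚᵘ (+ k) 0
  toℚᵘ-ℕ→ℚ k = cong toℚᵘ (ℕ→ℚ≡mkℚ k)

  ℕ→ℚ-homo-+ : ∀ m n → ℕ→ℚ (m ℕ.+ n) ≡ ℕ→ℚ m + ℕ→ℚ n
  ℕ→ℚ-homo-+ m n = toℚᵘ-injective (begin
    toℚᵘ (ℕ→ℚ (m ℕ.+ n))                  ≡⟨ toℚᵘ-ℕ→ℚ (m ℕ.+ n) ⟩
    ℚᵘ.mkℚᵘ (+ (m ℕ.+ n)) 0              ≈⟨ ℚᵘ.*≡* (trans (cong (ℤ._* + 1) (ℤ.pos-+ m n)) (ring (+ m) (+ n))) ⟩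
    ℚᵘ.mkℚᵘ (+ m) 0 ℚᵘ.+ ℚᵘ.mkℚᵘ (+ n) 0  ≡⟨ cong₂ ℚᵘ._+_ (toℚᵘ-ℕ→ℚ m) (toℚᵘ-ℕ→ℚ n) ⟨
    toℚᵘ (ℕ→ℚ m) ℚᵘ.+ toℚᵘ (ℕ→ℚ n)        ≈⟨ ℚᵘ.≃-sym (toℚᵘ-homo-+ (ℕ→ℚ m) (ℕ→ℚ n)) ⟩
    toℚᵘ (ℕ→ℚ m + ℕ→ℚ n)                  ∎)
    where
    open ℚᵘ.≃-Reasoning
    ring : ∀ x y → (x ℤ.+ y) ℤ.* + 1 ≡ (x ℤ.* + 1 ℤ.+ y ℤ.* + 1) ℤ.* + 1
    ring = solve-∀

  ℕ→ℚ-homo-* : ∀ m n → ℕ→ℚ (m ℕ.* n) ≡ ℕ→ℚ m * ℕ→ℚ n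
  ℕ→ℚ-homo-* m n = toℚᵘ-injective (begin
    toℚᵘ (ℕ→ℚ (m ℕ.* n))                  ≡⟨ toℚᵘ-ℕ→ℚ (m ℕ.* n) ⟩
    ℚᵘ.mkℚᵘ (+ (m ℕ.* n)) 0              ≈⟨ ℚᵘ.*≡* (cong (ℤ._* + 1) (ℤ.pos-* m n)) ⟩
    ℚᵘ.mkℚᵘ (+ m) 0 ℚᵘ.* ℚᵘ.mkℚᵘ (+ n) 0  ≡⟨ cong₂ ℚᵘ._*_ (toℚᵘ-ℕ→ℚ m) (toℚᵘ-ℕ→ℚ n) ⟨
    toℚᵘ (ℕ→ℚ m) ℚᵘ.* toℚᵘ (ℕ→ℚ n)        ≈⟨ ℚᵘ.≃-sym (toℚᵘ-homo-* (ℕ→ℚ m) (ℕ→ℚ n)) ⟩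
    toℚᵘ (ℕ→ℚ m * ℕ→ℚ n)                  ∎)
    where open ℚᵘ.≃-Reasoning

  ℕ→ℚ-mono-≤ : ∀ {m n} → m ℕ.≤ n → ℕ→ℚ m ≤ ℕ→ℚ n
  ℕ→ℚ-mono-≤ {m} {n} m≤n = subst₂ _≤_ (sym (ℕ→ℚ≡mkℚ m)) (sym (ℕ→ℚ≡mkℚ n))
    (*≤* (subst₂ ℤ._≤_ (sym (ℤ.*-identityʳ (+ m))) (sym (ℤ.*-identityʳ (+ n))) (ℤ.+≤+ m≤n)))

  ℕ→ℚ-cancel-≤ : ∀ {m n} → ℕ→ℚ m ≤ ℕ→ℚ n → m ℕ.≤ n
  ℕ→ℚ-cancel-≤ {m} {n} le = ℤ.drop‿+≤+
    (subst₂ ℤ._≤_ (ℤ.*-identityʳ (+ m)) (ℤ.*-identityʳ (+ n)) (drop-*≤* (subst₂ _≤_ (ℕ→ℚ≡mkℚ m) (ℕ→ℚ≡mkℚ n) le)))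

  ℕ→ℚ-nonNeg : ∀ k → NonNegative (ℕ→ℚ k)
  ℕ→ℚ-nonNeg k = nonNegative (ℕ→ℚ-mono-≤ {0} {k} ℕ.z≤n)

  ℕ→ℚ-pos : ∀ k .{{_ : ℕ.NonZero k}} → Positive (ℕ→ℚ k)
  ℕ→ℚ-pos k = positive (subst (0ℚ <_) (sym (ℕ→ℚ≡mkℚ k))
    (*<* (subst (+0 ℤ.<_) (sym (ℤ.*-identityʳ (+ k))) (ℤ.+<+ (ℕ.>-nonZero⁻¹ k)))))

  ℕ→ℚ-homo-*³ : ∀ x y z → ℕ→ℚ (x ℕ.* y ℕ.* z) ≡ ℕ→ℚ x * ℕ→ℚ y * ℕ→ℚ z
  ℕ→ℚ-homo-*³ x y z = trans (ℕ→ℚ-homo-* (x ℕ.* y) z) (cong (_* ℕ→ℚ z) (ℕ→ℚ-homo-* x y))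

  x-y≤z⇒x≤z+y : ∀ {x y z} → x - y ≤ z → x ≤ z + y
  x-y≤z⇒x≤z+y {x} {y} {z} h = ≤-trans (≤-reflexive (sym (cancel x y))) (+-monoˡ-≤ y h)
    where
    cancel : ∀ x y → x - y + y ≡ x
    cancel = solve 2 (λ x y → x :- y :+ y := x) refl

  x≤y+z⇒x-y≤z : ∀ {x y z} → x ≤ y + z → x - y ≤ z
  x≤y+z⇒x-y≤z {x} {y} {z} h = ≤-trans (+-monoˡ-≤ (- y) h) (≤-reflexive (cancel y z))
    where
    cancel : ∀ y z → y + z - y ≡ z
    cancel = solve 2 (λ y z → y :+ z :- y := z) refl

  record Fraction (x : ℚ) : Set where
    field
      num den : ℕ
      num≢0 : ℕ.NonZero num
      den≢0 : ℕ.NonZero den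
      x*den≡num : x * ℕ→ℚ den ≡ ℕ→ℚ num

  positive⇒fraction : ∀ x → 0ℚ < x → Fraction x
  positive⇒fraction x@(mkℚ +[1+ p ] q _) _ = record
    { num = suc p ; den = suc q ; num≢0 = _ ; den≢0 = _ ; x*den≡num = toℚᵘ-injective (begin
      toℚᵘ (x * ℕ→ℚ (suc q))               ≈⟨ toℚᵘ-homo-* x (ℕ→ℚ (suc q)) ⟩
      toℚᵘ x ℚᵘ.* toℚᵘ (ℕ→ℚ (suc q))        ≡⟨ cong (toℚᵘ x ℚᵘ.*_) (toℚᵘ-ℕ→ℚ (suc q)) ⟩
      toℚᵘ x ℚᵘ.* ℚᵘ.mkℚᵘ (+ suc q) 0      ≈⟨ ℚᵘ.*≡* (ring (+ suc p) (+ suc q)) ⟩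
      ℚᵘ.mkℚᵘ (+ suc p) 0                  ≡⟨ toℚᵘ-ℕ→ℚ (suc p) ⟨
      toℚᵘ (ℕ→ℚ (suc p))                    ∎) }
    where
    open ℚᵘ.≃-Reasoning
    ring : ∀ a b → a ℤ.* b ℤ.* + 1 ≡ a ℤ.* (b ℤ.* + 1)
    ring = solve-∀
  positive⇒fraction (mkℚ +0       _ _) (*<* (ℤ.+<+ ()))
  positive⇒fraction (mkℚ -[1+ _ ] _ _) (*<* ())

  ^ℚ-nonNeg : ∀ x k → 0ℚ ≤ x → 0ℚ ≤ x ^ℚ k
  ^ℚ-nonNeg x zero    _   = *≤* (ℤ.+≤+ ℕ.z≤n)
  ^ℚ-nonNeg x (suc k) 0≤x = ≤-trans (≤-reflexive (sym (*-zeroʳ x)))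
    (*-monoˡ-≤-nonNeg x {{nonNegative 0≤x}} (^ℚ-nonNeg x k 0≤x))

  ^ℚ-≤1 : ∀ x k → 0ℚ ≤ x → x ≤ 1ℚ → x ^ℚ k ≤ 1ℚ
  ^ℚ-≤1 x zero    _   _   = ≤-refl
  ^ℚ-≤1 x (suc k) 0≤x x≤1 = ≤-trans (*-monoˡ-≤-nonNeg x {{nonNegative 0≤x}} (^ℚ-≤1 x k 0≤x x≤1))
    (≤-trans (≤-reflexive (*-identityʳ x)) x≤1)

  ^ℚ-+ : ∀ x m n → x ^ℚ (m ℕ.+ n) ≡ x ^ℚ m * x ^ℚ n
  ^ℚ-+ x zero    n = sym (*-identityˡ (x ^ℚ n))
  ^ℚ-+ x (suc m) n = trans (cong (x *_) (^ℚ-+ x m n)) (sym (*-assoc x (x ^ℚ m) (x ^ℚ n)))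

module ClearingDenominators where

  open import Defs
  open Sums using (⟦_⟧; Σ²; Σ²-cong; Σ²-mono-≤; *-distribˡ-Σ²; *-distribʳ-Σ²; count-∧ˡ; count-const; ⟦⟧-weight)
  open Counting using (light; #light; CherryDenseℕ)
  open Rationals
  open import Data.Bool.Base using (true; T)
  open import Data.Nat.Base as ℕ using (ℕ)
  import Data.Nat.Properties as ℕ
  open import Data.Nat.Combinatorics using (_C_)
  open import Data.Nat.Tactic.RingSolver as ℕ-Solver using ()
  open import Data.Rational.Base
  open import Data.Rational.Properties
  open import Data.Rational.Solver using (module +-*-Solver)
  open +-*-Solver using (solve; _:+_; _:*_; _:-_; _:=_)
  open import Relation.Binary.PropositionalEquality
  open import Relation.Nullary.Decidable using (toWitnessFalse)

  module _ {n : ℕ} (H : 3Graph n) where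

    cherryDense⇒ℕ : ∀ {ρ d p q K} → d * ℕ→ℚ q ≡ ℕ→ℚ p → ρ * ℕ→ℚ (q ℕ.* K) ≤ 1ℚ →
      CherryDense ρ d H → CherryDenseℕ p q K H
    cherryDense⇒ℕ {ρ} {d} {p} {q} {K} dq≡p ρqK≤1 cherry G₁ G₂ = ℕ→ℚ-cancel-≤ (begin
      ℕ→ℚ (p ℕ.* K ℕ.* P)                      ≡⟨ ℕ→ℚ-homo-*³ p K P ⟩
      ℕ→ℚ p * ℕ→ℚ K * ℕ→ℚ P                    ≡⟨ cong (λ t → t * ℕ→ℚ K * ℕ→ℚ P) dq≡p ⟨
      d * ℕ→ℚ q * ℕ→ℚ K * ℕ→ℚ P                ≡⟨ ring₁ d (ℕ→ℚ q) (ℕ→ℚ K) (ℕ→ℚ P) ⟩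
      d * ℕ→ℚ P * (ℕ→ℚ q * ℕ→ℚ K)              ≡⟨ cong (d * ℕ→ℚ P *_) (ℕ→ℚ-homo-* q K) ⟨
      d * ℕ→ℚ P * qK
        ≤⟨ *-monoʳ-≤-nonNeg qK {{ℕ→ℚ-nonNeg (q ℕ.* K)}} (x-y≤z⇒x≤z+y {d * ℕ→ℚ P} (cherry G₁ G₂)) ⟩
      (ℕ→ℚ e + ρ * N³) * qK                    ≡⟨ ring₂ (ℕ→ℚ e) ρ N³ qK ⟩
      ℕ→ℚ e * qK + ρ * qK * N³
        ≤⟨ +-monoʳ-≤ (ℕ→ℚ e * qK) (*-monoʳ-≤-nonNeg N³ {{ℕ→ℚ-nonNeg (n ℕ.^ 3)}} ρqK≤1) ⟩
      ℕ→ℚ e * qK + 1ℚ * N³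
        ≡⟨ cong₂ _+_ (trans (*-comm (ℕ→ℚ e) qK) (sym (ℕ→ℚ-homo-* (q ℕ.* K) e))) (*-identityˡ N³) ⟩
      ℕ→ℚ (q ℕ.* K ℕ.* e) + N³                 ≡⟨ ℕ→ℚ-homo-+ (q ℕ.* K ℕ.* e) (n ℕ.^ 3) ⟨
      ℕ→ℚ (q ℕ.* K ℕ.* e ℕ.+ n ℕ.^ 3)          ∎)
      where
      open ≤-Reasoning
      P = |P₂| G₁ G₂
      e = e[ H ] G₁ G₂
      N³ = ℕ→ℚ (n ℕ.^ 3)
      qK = ℕ→ℚ (q ℕ.* K)
      ring₁ : ∀ d q K P → d * q * K * P ≡ d * P * (q * K)
      ring₁ = solve 4 (λ d q K P → d :* q :* K :* P := d :* P :* (q :* K)) refl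
      ring₂ : ∀ e ρ N k → (e + ρ * N) * k ≡ e * k + ρ * k * N
      ring₂ = solve 4 (λ e ρ N k → (e :+ ρ :* N) :* k := e :* k :+ ρ :* k :* N) refl

    minDeg⇒ℕ : ∀ {α a b} → α * ℕ→ℚ b ≡ ℕ→ℚ a → MinDegAtLeast H α → ∀ v → a ℕ.* ((n ℕ.∸ 1) C 2) ℕ.≤ b ℕ.* deg H v
    minDeg⇒ℕ {α} {a} {b} αb≡a min-deg v = ℕ→ℚ-cancel-≤ (begin
      ℕ→ℚ (a ℕ.* c)               ≡⟨ ℕ→ℚ-homo-* a c ⟩
      ℕ→ℚ a * ℕ→ℚ c               ≡⟨ cong (_* ℕ→ℚ c) αb≡a ⟨
      α * ℕ→ℚ b * ℕ→ℚ c           ≡⟨ ring α (ℕ→ℚ b) (ℕ→ℚ c) ⟩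
      ℕ→ℚ b * (ℕ→ℚ c * α)         ≤⟨ *-monoˡ-≤-nonNeg (ℕ→ℚ b) {{ℕ→ℚ-nonNeg b}} (min-deg v) ⟩
      ℕ→ℚ b * ℕ→ℚ (deg H v)       ≡⟨ ℕ→ℚ-homo-* b (deg H v) ⟨
      ℕ→ℚ (b ℕ.* deg H v)         ∎)
      where
      open ≤-Reasoning
      c = (n ℕ.∸ 1) C 2
      ring : ∀ α b c → α * b * c ≡ b * (c * α)
      ring = solve 3 (λ α b c → α :* b :* c := b :* (c :* α)) refl

    module _ (β : ℚ) where

      allPairs : Rel₂ n
      allPairs _ _ = true

      light⇒few-edges : ∀ {r s} .{{_ : ℕ.NonZero s}} → β * ℕ→ℚ s ≡ ℕ→ℚ r →
        ∀ x y → T (light H β x y) → s ℕ.* codeg H x y ℕ.≤ r ℕ.* n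
      light⇒few-edges {r} {s} βs≡r x y t = ℕ→ℚ-cancel-≤ (<⇒≤ (begin-strict
        ℕ→ℚ (s ℕ.* c)            ≡⟨ ℕ→ℚ-homo-* s c ⟩
        ℕ→ℚ s * ℕ→ℚ c            <⟨ *-monoʳ-<-pos (ℕ→ℚ s) {{ℕ→ℚ-pos s}} (≰⇒> (toWitnessFalse t)) ⟩
        ℕ→ℚ s * (β * ℕ→ℚ n)      ≡⟨ ring (ℕ→ℚ s) β (ℕ→ℚ n) ⟩
        β * ℕ→ℚ s * ℕ→ℚ n        ≡⟨ cong (_* ℕ→ℚ n) βs≡r ⟩
        ℕ→ℚ r * ℕ→ℚ n            ≡⟨ ℕ→ℚ-homo-* r n ⟨
        ℕ→ℚ (r ℕ.* n)            ∎))
        where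
        open ≤-Reasoning
        c = codeg H x y
        ring : ∀ s β n → s * (β * n) ≡ β * s * n
        ring = solve 3 (λ s β n → s :* (β :* n) := β :* s :* n) refl

      light-pairs-few-edges : ∀ {r s} .{{_ : ℕ.NonZero s}} → β * ℕ→ℚ s ≡ ℕ→ℚ r →
        s ℕ.* e[ H ] (light H β) allPairs ℕ.≤ r ℕ.* (#light H β ℕ.* n)
      light-pairs-few-edges {r} {s} βs≡r = begin
        s ℕ.* e[ H ] (light H β) allPairs
          ≡⟨ cong (s ℕ.*_) (Σ²-cong λ x y → count-∧ˡ (light H β x y) (edge H x y)) ⟩
        s ℕ.* Σ² (λ x y → ⟦ light H β x y ⟧ ℕ.* codeg H x y) ≡⟨ *-distribˡ-Σ² {n} s _ ⟩
        Σ² (λ x y → s ℕ.* (⟦ light H β x y ⟧ ℕ.* codeg H x y))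
          ≤⟨ Σ²-mono-≤ (λ x y → ℕ.≤-trans (ℕ.≤-reflexive (swap s ⟦ light H β x y ⟧ (codeg H x y)))
                                            (⟦⟧-weight (light H β x y) (light⇒few-edges {r} {s} βs≡r x y))) ⟩
        Σ² (λ x y → ⟦ light H β x y ⟧ ℕ.* (r ℕ.* n)) ≡⟨ *-distribʳ-Σ² {n} (r ℕ.* n) _ ⟨
        #light H β ℕ.* (r ℕ.* n) ≡⟨ swap (#light H β) r n ⟩
        r ℕ.* (#light H β ℕ.* n) ∎
        where
        open ℕ.≤-Reasoning
        swap : ∀ s l c → s ℕ.* (l ℕ.* c) ≡ l ℕ.* (s ℕ.* c)
        swap = ℕ-Solver.solve-∀

      |P₂|-light : |P₂| (light H β) allPairs ≡ #light H β ℕ.* n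
      |P₂|-light = begin
        |P₂| (light H β) allPairs
          ≡⟨ Σ²-cong (λ x y → trans (count-∧ˡ {n} (light H β x y) (λ _ → true))
                                    (cong (⟦ light H β x y ⟧ ℕ.*_) (count-const {n} true))) ⟩
        Σ² (λ x y → ⟦ light H β x y ⟧ ℕ.* (n ℕ.* 1)) ≡⟨ *-distribʳ-Σ² {n} (n ℕ.* 1) _ ⟨
        #light H β ℕ.* (n ℕ.* 1) ≡⟨ cong (#light H β ℕ.*_) (ℕ.*-identityʳ n) ⟩
        #light H β ℕ.* n ∎
        where open ≡-Reasoning

      few-light-pairs : ∀ {ρ d K r s} .{{_ : ℕ.NonZero s}} .{{_ : ℕ.NonZero n}} .{{_ : Positive (d - β)}} →
        β * ℕ→ℚ s ≡ ℕ→ℚ r → ρ * ℕ→ℚ K ≤ d - β → CherryDense ρ d H → K ℕ.* #light H β ℕ.≤ n ℕ.* n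
      few-light-pairs {ρ} {d} {K} {r} {s} βs≡r ρK≤d-β cherry =
        ℕ.*-cancelʳ-≤ (K ℕ.* #light H β) (n ℕ.* n) n
          (ℕ.≤-trans (ℕ.≤-reflexive (swap K (#light H β) n)) (ℕ.≤-trans (ℕ→ℚ-cancel-≤ LnK≤n³) (ℕ.≤-reflexive (cube n))))
        where
        X = ℕ→ℚ (#light H β ℕ.* n)
        N³ = ℕ→ℚ (n ℕ.^ 3)
        e = e[ H ] (light H β) allPairs
        swap : ∀ K L n → K ℕ.* L ℕ.* n ≡ L ℕ.* n ℕ.* K
        swap = ℕ-Solver.solve-∀
        cube : ∀ n → n ℕ.* (n ℕ.* (n ℕ.* 1)) ≡ n ℕ.* n ℕ.* n
        cube = ℕ-Solver.solve-∀
        e≤βX : ℕ→ℚ e ≤ β * X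
        e≤βX = *-cancelˡ-≤-pos (ℕ→ℚ s) {{ℕ→ℚ-pos s}} (begin
          ℕ→ℚ s * ℕ→ℚ e ≡⟨ ℕ→ℚ-homo-* s e ⟨
          ℕ→ℚ (s ℕ.* e) ≤⟨ ℕ→ℚ-mono-≤ (light-pairs-few-edges {r} {s} βs≡r) ⟩
          ℕ→ℚ (r ℕ.* (#light H β ℕ.* n)) ≡⟨ ℕ→ℚ-homo-* r (#light H β ℕ.* n) ⟩
          ℕ→ℚ r * X ≡⟨ cong (_* X) βs≡r ⟨
          β * ℕ→ℚ s * X ≡⟨ ring (ℕ→ℚ s) β X ⟩
          ℕ→ℚ s * (β * X) ∎)
          where
          open ≤-Reasoning
          ring : ∀ s β X → β * s * X ≡ s * (β * X)
          ring = solve 3 (λ s β X → β :* s :* X := s :* (β :* X)) refl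
        cherry-light : d * X - ρ * N³ ≤ ℕ→ℚ e
        cherry-light = subst (λ t → d * ℕ→ℚ t - ρ * N³ ≤ ℕ→ℚ e) |P₂|-light (cherry (light H β) allPairs)
        [d-β]X≤ρN³ : (d - β) * X ≤ ρ * N³
        [d-β]X≤ρN³ = begin
          (d - β) * X ≡⟨ ring d β X ⟩
          d * X - β * X ≤⟨ x≤y+z⇒x-y≤z (≤-trans (x-y≤z⇒x≤z+y {d * X} cherry-light) (+-monoˡ-≤ (ρ * N³) e≤βX)) ⟩
          ρ * N³ ∎
          where
          open ≤-Reasoning
          ring : ∀ d β X → (d - β) * X ≡ d * X - β * X
          ring = solve 3 (λ d β X → (d :- β) :* X := d :* X :- β :* X) refl
        LnK≤n³ : ℕ→ℚ (#light H β ℕ.* n ℕ.* K) ≤ N³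
        LnK≤n³ = *-cancelˡ-≤-pos (d - β) (begin
          (d - β) * ℕ→ℚ (#light H β ℕ.* n ℕ.* K) ≡⟨ cong ((d - β) *_) (ℕ→ℚ-homo-* (#light H β ℕ.* n) K) ⟩
          (d - β) * (X * ℕ→ℚ K) ≡⟨ *-assoc (d - β) X (ℕ→ℚ K) ⟨
          (d - β) * X * ℕ→ℚ K ≤⟨ *-monoʳ-≤-nonNeg (ℕ→ℚ K) {{ℕ→ℚ-nonNeg K}} [d-β]X≤ρN³ ⟩
          ρ * N³ * ℕ→ℚ K ≡⟨ ring ρ N³ (ℕ→ℚ K) ⟩
          ρ * ℕ→ℚ K * N³ ≤⟨ *-monoʳ-≤-nonNeg N³ {{ℕ→ℚ-nonNeg (n ℕ.^ 3)}} ρK≤d-β ⟩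
          (d - β) * N³ ∎)
          where
          open ≤-Reasoning
          ring : ∀ ρ N K → ρ * N * K ≡ ρ * K * N
          ring = solve 3 (λ ρ N K → ρ :* N :* K := ρ :* K :* N) refl

open import Defs
open Counting using (#light; CherryDenseℕ; M; M≢0; module Link)
open Rationals
open ClearingDenominators
open import Data.Integer.Base using (+_)
open import Data.Nat.Base as ℕ using (ℕ; _≥_)
import Data.Nat
import Data.Nat.Properties as ℕ
open import Data.Nat.Tactic.RingSolver as ℕ-Solver using ()
open import Data.Fin.Base using (Fin)
open import Data.Nat.Combinatorics using (_C_)
open import Data.Product using (Σ; _×_; _,_)
open import Data.Rational.Base hiding (_≥_)
open import Data.Rational.Properties
open import Data.Rational.Solver using (module +-*-Solver)
open +-*-Solver using (solve; _:*_; _:=_; con)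
open import Relation.Binary.PropositionalEquality

ℕ-bound⇒α³d²-bound : ∀ {α d a b p q n A} .{{_ : ℕ.NonZero b}} .{{_ : ℕ.NonZero q}} →
  α * ℕ→ℚ b ≡ ℕ→ℚ a → d * ℕ→ℚ q ≡ ℕ→ℚ p →
  a ℕ.* a ℕ.* a ℕ.* (p ℕ.* p) ℕ.* (n ℕ.* n ℕ.* n ℕ.* n) ℕ.≤ 512 ℕ.* (b ℕ.* b ℕ.* b) ℕ.* (q ℕ.* q) ℕ.* A →
  α ^ℚ 3 * d ^ℚ 2 * ℕ→ℚ (n ℕ.^ 4) ≤ ℕ→ℚ 512 * ℕ→ℚ A
ℕ-bound⇒α³d²-bound {α} {d} {a} {b} {p} {q} {n} {A} αb≡a dq≡p cleared =
  *-cancelʳ-≤-pos W {{ℕ→ℚ-pos (b ℕ.* b ℕ.* b ℕ.* (q ℕ.* q)) {{b³q²≢0}}}} (subst₂ _≤_ lhs rhs (ℕ→ℚ-mono-≤ cleared))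
  where
  b′ = ℕ→ℚ b
  q′ = ℕ→ℚ q
  W = ℕ→ℚ (b ℕ.* b ℕ.* b ℕ.* (q ℕ.* q))
  b³q²≢0 : ℕ.NonZero (b ℕ.* b ℕ.* b ℕ.* (q ℕ.* q))
  b³q²≢0 = ℕ.m*n≢0 (b ℕ.* b ℕ.* b) (q ℕ.* q) {{ℕ.m*n≢0 (b ℕ.* b) b {{ℕ.m*n≢0 b b}}}} {{ℕ.m*n≢0 q q}}
  W≡ : W ≡ b′ * b′ * b′ * (q′ * q′)
  W≡ = trans (ℕ→ℚ-homo-* (b ℕ.* b ℕ.* b) (q ℕ.* q)) (cong₂ _*_ (ℕ→ℚ-homo-*³ b b b) (ℕ→ℚ-homo-* q q))
  n⁴ : ∀ n → n ℕ.* n ℕ.* n ℕ.* n ≡ n ℕ.* (n ℕ.* (n ℕ.* (n ℕ.* 1)))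
  n⁴ = ℕ-Solver.solve-∀
  lhs : ℕ→ℚ (a ℕ.* a ℕ.* a ℕ.* (p ℕ.* p) ℕ.* (n ℕ.* n ℕ.* n ℕ.* n)) ≡ α ^ℚ 3 * d ^ℚ 2 * ℕ→ℚ (n ℕ.^ 4) * W
  lhs = begin
    ℕ→ℚ (a ℕ.* a ℕ.* a ℕ.* (p ℕ.* p) ℕ.* (n ℕ.* n ℕ.* n ℕ.* n))
      ≡⟨ ℕ→ℚ-homo-*³ (a ℕ.* a ℕ.* a) (p ℕ.* p) (n ℕ.* n ℕ.* n ℕ.* n) ⟩
    ℕ→ℚ (a ℕ.* a ℕ.* a) * ℕ→ℚ (p ℕ.* p) * ℕ→ℚ (n ℕ.* n ℕ.* n ℕ.* n)
      ≡⟨ cong₂ _*_ (cong₂ _*_ (ℕ→ℚ-homo-*³ a a a) (ℕ→ℚ-homo-* p p)) (cong ℕ→ℚ (n⁴ n)) ⟩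
    ℕ→ℚ a * ℕ→ℚ a * ℕ→ℚ a * (ℕ→ℚ p * ℕ→ℚ p) * ℕ→ℚ (n ℕ.^ 4)
      ≡⟨ cong₂ (λ x y → x * x * x * (y * y) * ℕ→ℚ (n ℕ.^ 4)) αb≡a dq≡p ⟨
    α * b′ * (α * b′) * (α * b′) * (d * q′ * (d * q′)) * ℕ→ℚ (n ℕ.^ 4)
      ≡⟨ ring α b′ d q′ (ℕ→ℚ (n ℕ.^ 4)) ⟩
    α ^ℚ 3 * d ^ℚ 2 * ℕ→ℚ (n ℕ.^ 4) * (b′ * b′ * b′ * (q′ * q′))
      ≡⟨ cong (α ^ℚ 3 * d ^ℚ 2 * ℕ→ℚ (n ℕ.^ 4) *_) W≡ ⟨
    α ^ℚ 3 * d ^ℚ 2 * ℕ→ℚ (n ℕ.^ 4) * W ∎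
    where
    open ≡-Reasoning
    ring : ∀ α b d q N → α * b * (α * b) * (α * b) * (d * q * (d * q)) * N
                         ≡ α * (α * (α * 1ℚ)) * (d * (d * 1ℚ)) * N * (b * b * b * (q * q))
    ring = solve 5 (λ α b d q N → α :* b :* (α :* b) :* (α :* b) :* (d :* q :* (d :* q)) :* N
                   := α :* (α :* (α :* con 1ℚ)) :* (d :* (d :* con 1ℚ)) :* N :* (b :* b :* b :* (q :* q))) refl
  rhs : ℕ→ℚ (512 ℕ.* (b ℕ.* b ℕ.* b) ℕ.* (q ℕ.* q) ℕ.* A) ≡ ℕ→ℚ 512 * ℕ→ℚ A * W
  rhs = begin
    ℕ→ℚ (512 ℕ.* (b ℕ.* b ℕ.* b) ℕ.* (q ℕ.* q) ℕ.* A)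
      ≡⟨ ℕ→ℚ-homo-* (512 ℕ.* (b ℕ.* b ℕ.* b) ℕ.* (q ℕ.* q)) A ⟩
    ℕ→ℚ (512 ℕ.* (b ℕ.* b ℕ.* b) ℕ.* (q ℕ.* q)) * ℕ→ℚ A
      ≡⟨ cong (_* ℕ→ℚ A) (ℕ→ℚ-homo-*³ 512 (b ℕ.* b ℕ.* b) (q ℕ.* q)) ⟩
    ℕ→ℚ 512 * ℕ→ℚ (b ℕ.* b ℕ.* b) * ℕ→ℚ (q ℕ.* q) * ℕ→ℚ A
      ≡⟨ ring (ℕ→ℚ 512) (ℕ→ℚ (b ℕ.* b ℕ.* b)) (ℕ→ℚ (q ℕ.* q)) (ℕ→ℚ A) ⟩
    ℕ→ℚ 512 * ℕ→ℚ A * (ℕ→ℚ (b ℕ.* b ℕ.* b) * ℕ→ℚ (q ℕ.* q))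
      ≡⟨ cong (ℕ→ℚ 512 * ℕ→ℚ A *_) (ℕ→ℚ-homo-* (b ℕ.* b ℕ.* b) (q ℕ.* q)) ⟨
    ℕ→ℚ 512 * ℕ→ℚ A * W ∎
    where
    open ≡-Reasoning
    ring : ∀ c B Q A → c * B * Q * A ≡ c * A * (B * Q)
    ring = solve 4 (λ c B Q A → c :* B :* Q :* A := c :* A :* (B :* Q)) refl

α³d²-bound⇒d²α⁹-bound : ∀ {α d N A} → 0ℚ ≤ α → α ≤ 1ℚ → α ^ℚ 3 * d ^ℚ 2 * N ≤ ℕ→ℚ 512 * ℕ→ℚ A →
  d ^ℚ 2 * α ^ℚ 9 * (+ 1 / 281474976710656) * N ≤ ℕ→ℚ A
α³d²-bound⇒d²α⁹-bound {α} {d} {N} {A} 0≤α α≤1 bound = begin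
  d ^ℚ 2 * α ^ℚ 9 * c * N          ≡⟨ cong (λ t → d ^ℚ 2 * t * c * N) (^ℚ-+ α 6 3) ⟩
  d ^ℚ 2 * (α⁶ * α ^ℚ 3) * c * N    ≡⟨ ring (d ^ℚ 2) α⁶ (α ^ℚ 3) c N ⟩
  α⁶ * (c * (α ^ℚ 3 * d ^ℚ 2 * N))  ≤⟨ *-monoˡ-≤-nonNeg α⁶ {{α⁶≥0}} (*-monoˡ-≤-nonNeg c {{c≥0}} bound) ⟩
  α⁶ * (c * (ℕ→ℚ 512 * A′))         ≡⟨ cong (α⁶ *_) (*-assoc c (ℕ→ℚ 512) A′) ⟨
  α⁶ * (c * ℕ→ℚ 512 * A′)           ≤⟨ *-monoˡ-≤-nonNeg α⁶ {{α⁶≥0}} (*-monoʳ-≤-nonNeg A′ {{ℕ→ℚ-nonNeg A}} c·512≤1) ⟩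
  α⁶ * (1ℚ * A′)                    ≡⟨ cong (α⁶ *_) (*-identityˡ A′) ⟩
  α⁶ * A′                           ≤⟨ *-monoʳ-≤-nonNeg A′ {{ℕ→ℚ-nonNeg A}} (^ℚ-≤1 α 6 0≤α α≤1) ⟩
  1ℚ * A′                           ≡⟨ *-identityˡ A′ ⟩
  A′                                ∎
  where
  open ≤-Reasoning
  c = + 1 / 281474976710656
  α⁶ = α ^ℚ 6
  A′ = ℕ→ℚ A
  α⁶≥0 : NonNegative α⁶
  α⁶≥0 = nonNegative (^ℚ-nonNeg α 6 0≤α)
  c≥0 : NonNegative c
  c≥0 = nonNegative {c} (≤ᵇ⇒≤ _)
  c·512≤1 : c * ℕ→ℚ 512 ≤ 1ℚ
  c·512≤1 = ≤ᵇ⇒≤ _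
  ring : ∀ D a b c N → D * (a * b) * c * N ≡ a * (c * (b * D * N))
  ring = solve 5 (λ D a b c N → D :* (a :* b) :* c :* N := a :* (c :* (b :* D :* N))) refl

module Fractions {d α β : ℚ} (d-frac : Fraction d) (α-frac : Fraction α) (β-frac : Fraction β)
  (0≤α : 0ℚ ≤ α) (α≤1 : α ≤ 1ℚ) (0≤β : 0ℚ ≤ β) (β<d : β < d) (d≤1 : d ≤ 1ℚ) where

  open Fraction d-frac using () renaming (num to p; den to q; num≢0 to p≢0; den≢0 to q≢0; x*den≡num to dq≡p)
  open Fraction α-frac using () renaming (num to a; den to b; num≢0 to a≢0; den≢0 to b≢0; x*den≡num to αb≡a)
  open Fraction β-frac using () renaming (num to r; den to s; den≢0 to s≢0; x*den≡num to βs≡r)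

  K : ℕ
  K = q ℕ.* M b q

  K>0 : Positive (ℕ→ℚ K)
  K>0 = ℕ→ℚ-pos K {{ℕ.m*n≢0 q (M b q) {{q≢0}} {{M≢0 b q {{b≢0}} {{q≢0}}}}}}

  K≢0 : NonZero (ℕ→ℚ K)
  K≢0 = pos⇒nonZero (ℕ→ℚ K) {{K>0}}

  d-β>0 : Positive (d - β)
  d-β>0 = positive (subst (_< d - β) (+-inverseʳ β) (+-monoˡ-< (- β) β<d))

  ρ₄ : ℚ
  ρ₄ = (d - β) * (1/ ℕ→ℚ K) {{K≢0}}

  ρ₄>0 : 0ℚ < ρ₄
  ρ₄>0 = positive⁻¹ ρ₄ {{pos*pos⇒pos (d - β) {{d-β>0}} ((1/ ℕ→ℚ K) {{K≢0}}) {{1/pos⇒pos (ℕ→ℚ K) {{K>0}}}}}}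

  ρ<ρ₄⇒ρK≤d-β : ∀ {ρ} → ρ < ρ₄ → ρ * ℕ→ℚ K ≤ d - β
  ρ<ρ₄⇒ρK≤d-β {ρ} ρ<ρ₄ = begin
    ρ * ℕ→ℚ K                     ≤⟨ *-monoʳ-≤-nonNeg (ℕ→ℚ K) {{ℕ→ℚ-nonNeg K}} (<⇒≤ ρ<ρ₄) ⟩
    (d - β) * K⁻¹ * ℕ→ℚ K         ≡⟨ *-assoc (d - β) K⁻¹ (ℕ→ℚ K) ⟩
    (d - β) * (K⁻¹ * ℕ→ℚ K)       ≡⟨ cong ((d - β) *_) (*-inverseˡ (ℕ→ℚ K) {{K≢0}}) ⟩
    (d - β) * 1ℚ                  ≡⟨ *-identityʳ (d - β) ⟩
    d - β                         ∎
    where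
    open ≤-Reasoning
    K⁻¹ = (1/ ℕ→ℚ K) {{K≢0}}

  d-β≤1 : d - β ≤ 1ℚ
  d-β≤1 = ≤-trans (+-monoʳ-≤ d (neg-antimono-≤ 0≤β)) (≤-trans (≤-reflexive (+-identityʳ d)) d≤1)

  absorbers-bound : ∀ {n} → n ≥ 24 → ∀ {ρ} → ρ < ρ₄ → (H : 3Graph n) →
    CherryDense ρ d H → MinDegAtLeast H α → (v : Fin n) →
    d ^ℚ 2 * α ^ℚ 9 * (+ 1 / 281474976710656) * ℕ→ℚ (n ℕ.^ 4) ≤ ℕ→ℚ (#absorbers H β v)
  absorbers-bound {n} n≥24 {ρ} ρ<ρ₄ H cherry min-deg v =
    α³d²-bound⇒d²α⁹-bound {α} {d} {ℕ→ℚ (n ℕ.^ 4)} {#absorbers H β v} 0≤α α≤1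
      (ℕ-bound⇒α³d²-bound {α} {d} {a} {b} {p} {q} {n} {#absorbers H β v} {{b≢0}} {{q≢0}} αb≡a dq≡p cleared-bound)
    where
    n≢0 : ℕ.NonZero n
    n≢0 = ℕ.>-nonZero (ℕ.<-≤-trans (ℕ.s≤s ℕ.z≤n) n≥24)
    ρK≤d-β : ρ * ℕ→ℚ K ≤ d - β
    ρK≤d-β = ρ<ρ₄⇒ρK≤d-β {ρ} ρ<ρ₄
    cherryℕ : CherryDenseℕ p q (M b q) H
    cherryℕ = cherryDense⇒ℕ H {ρ} {d} {p} {q} dq≡p (≤-trans ρK≤d-β d-β≤1) cherry
    min-degℕ : a ℕ.* ((n ℕ.∸ 1) C 2) ℕ.≤ b ℕ.* deg H v
    min-degℕ = minDeg⇒ℕ H {α} {a} {b} αb≡a min-deg v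
    few-light : M b q ℕ.* #light H β ℕ.≤ n ℕ.* n
    few-light = ℕ.≤-trans (ℕ.*-monoˡ-≤ (#light H β) (ℕ.m≤n*m (M b q) q {{q≢0}}))
      (few-light-pairs H β {ρ} {d} {K} {r} {s} {{s≢0}} {{n≢0}} {{d-β>0}} βs≡r ρK≤d-β cherry)
    cleared-bound : a ℕ.* a ℕ.* a ℕ.* (p ℕ.* p) ℕ.* (n ℕ.* n ℕ.* n ℕ.* n)
                      ℕ.≤ 512 ℕ.* (b ℕ.* b ℕ.* b) ℕ.* (q ℕ.* q) ℕ.* #absorbers H β v
    cleared-bound = Link.Thresholds.absorbers-lower-boundℕ H v a b p q {{a≢0}} {{b≢0}} {{p≢0}} {{q≢0}} {{n≢0}}
      cherryℕ β n≥24 min-degℕ few-light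

lemma4p1 : (d α β : ℚ) → 0ℚ < d → d ≤ 1ℚ → 0ℚ < α → α ≤ 1ℚ → 0ℚ < β → β ≤ 1ℚ → β < d →
    Σ ℕ λ n₄ → Σ ℚ λ ρ₄ → 0ℚ < ρ₄ ×
      (∀ (n : ℕ) → n ≥ n₄ → (ρ : ℚ) → ρ < ρ₄ → (H : 3Graph n) →
        CherryDense ρ d H → MinDegAtLeast H α → (v : Fin n) →
        (d ^ℚ 2) * (α ^ℚ 9) * ((+ 1) / 281474976710656) * ℕ→ℚ (n Data.Nat.^ 4)
          ≤ ℕ→ℚ (#absorbers H β v))
lemma4p1 d α β 0<d d≤1 0<α α≤1 0<β β≤1 β<d = 24 , ρ₄ , ρ₄>0 , λ n n≥24 ρ ρ<ρ₄ → absorbers-bound n≥24 ρ<ρ₄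
  where open Fractions (positive⇒fraction d 0<d) (positive⇒fraction α 0<α) (positive⇒fraction β 0<β)
                       (<⇒≤ 0<α) α≤1 (<⇒≤ 0<β) β<d d≤1
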